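{- Let $t\geq 1$, $\ell\geq 3$, $k\geq t+\ell-2$ be integers and let $\mathcal{F}\subset\binom{[n]}{k}$ be a family such that $\binom{\ell}{2}(t-1)+\binom{\ell-1}{2}\leq \sum_{1\leq i<j\leq \ell}|F_i\cap F_j|$ for every choice of $\ell$ distinct members $F_1,\dots,F_\ell$ of $\mathcal{F}$. Suppose $\mathcal{F}$ contains a sunflower with a kernel $T$ of size $t$ and $2k+\ell-2$ petals. For $a\in T$ let $\mathcal{F}(T-\{a\},\bar a)=\{F\in\mathcal{F}: T\setminus\{a\}\subseteq F,\ a\notin F\}$. If $a,b\in T$, $a\neq b$, then the families $\{F\setminus T: F\in\mathcal{F}(T-\{a\},\bar a)\}$ and $\{G\setminus T: G\in\mathcal{F}(T-\{b\},\bar b)\}$ are cross $(\ell-1)$-intersecting, i.e. $|(F\setminus T)\cap(G\setminus T)|\geq \ell-1$ for all $F\in\mathcal{F}(T-\{a\},\bar a)$, $G\in\mathcal{F}(T-\{b\},\bar b)$.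
   Context: $\binom{[n]}{k}$ denotes the family of all $k$-element subsets of $[n]=\{1,\dots,n\}$. A sunflower with kernel $T$ ($|T|=t$) and $u$ petals is a family of $u$ sets $T\cup P_1,\dots,T\cup P_u$ of size $k$, where $P_1,\dots,P_u$ (the petals) are pairwise disjoint and disjoint from $T$. -}

module Defs where

open import Data.Nat using (ℕ; zero; suc; _+_; _<ᵇ_)
open import Data.Fin using (Fin; zero; suc; toℕ)
open import Data.Fin.Subset using (Subset; _∈_; _∉_; _⊆_; _∩_; _∪_; _─_; _-_; ∣_∣; ⊥)
open import Data.Bool using (if_then_else_)
open import Data.Product using (Σ; _×_)
open import Relation.Binary.PropositionalEquality using (_≡_; _≢_)

Family : ℕ → Set₁
Family n = Subset n → Set

sumFin : (m : ℕ) → (Fin m → ℕ) → ℕ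
sumFin zero    f = 0
sumFin (suc m) f = f zero + sumFin m (λ i → f (suc i))

pairSum : (ℓ : ℕ) → (Fin ℓ → Fin ℓ → ℕ) → ℕ
pairSum ℓ g = sumFin ℓ (λ i → sumFin ℓ (λ j → if toℕ i <ᵇ toℕ j then g i j else 0))

Uniform : ∀ {n} → ℕ → Family n → Set
Uniform k 𝓕 = ∀ F → 𝓕 F → ∣ F ∣ ≡ k

DistinctMembers : ∀ {n} → Family n → (ℓ : ℕ) → (Fin ℓ → Subset n) → Set
DistinctMembers 𝓕 ℓ Fs = (∀ i → 𝓕 (Fs i)) × (∀ i j → i ≢ j → Fs i ≢ Fs j)

HasSunflower : ∀ {n} → Family n → ℕ → Subset n → ℕ → Set
HasSunflower {n} 𝓕 k T u =
  Σ (Fin u → Subset n) λ P →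
    (∀ i → T ∩ P i ≡ ⊥) ×
    (∀ i j → i ≢ j → P i ∩ P j ≡ ⊥) ×
    (∀ i → 𝓕 (T ∪ P i)) ×
    (∀ i → ∣ T ∪ P i ∣ ≡ k)

InLink : ∀ {n} → Family n → Subset n → Fin n → Subset n → Set
InLink 𝓕 T a F = 𝓕 F × ((T - a) ⊆ F) × (a ∉ F)

-- Write ℓ = M + 2 and t = r + 1. The 2k + M petals of the sunflower are pairwise disjoint
-- and |F ∪ G| ≤ 2k, so M of them avoid F ∪ G; call the corresponding members S₁, …, S_M.
-- The ℓ sets F, G, S₁, …, S_M are distinct (a ∈ G but a ∉ F, b ∈ S_j but b ∉ G, and the
-- petals are nonempty as k > t), and one has S_i ∩ S_j = T, F ∩ S_j ⊆ T - a,
-- G ∩ S_j ⊆ T - b and F ∩ G ⊆ (T - a - b) ∪ ((F ─ T) ∩ (G ─ T)). Summing,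
-- the pairwise intersections total at most (r - 1) + x + 2Mr + C(M,2)(r + 1) with
-- x = |(F ─ T) ∩ (G ─ T)|, and comparing with the hypothesis C(M+2,2) r + C(M+1,2)
-- leaves exactly x ≥ M + 1 = ℓ - 1.

module Submission where

open import Defs
open import Data.Nat using (ℕ; _+_; _*_; _∸_; _≤_)
open import Data.Nat.Combinatorics using (_C_)
open import Data.Fin using (Fin)
open import Data.Fin.Subset using (Subset; _∈_; _∩_; _─_; ∣_∣)
open import Relation.Binary.PropositionalEquality using (_≡_; _≢_)

open import Data.Nat using (zero; suc; z≤n; s≤s; s≤s⁻¹; _<_)
open import Data.Nat.Properties hiding (suc-injective)
open import Data.Nat.Combinatorics using (nC1≡n; nCk+nC[k+1]≡[n+1]C[k+1])
open import Data.Nat.Tactic.RingSolver using (solve-∀)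
open import Data.Fin using (zero; suc)
open import Data.Fin.Properties using (suc-injective)
open import Data.Fin.Subset using (_∪_; _-_; _∉_; _⊆_; Nonempty; ⊥)
open import Data.Fin.Subset.Properties
open import Data.Vec.Functional using (_∷_)
open import Data.Product using (Σ; _×_; _,_; proj₁; proj₂)
open import Data.Sum using (inj₁; inj₂)
open import Function using (_∘_)
open import Function.Definitions using (Injective)
open import Relation.Nullary using (yes; no; contradiction)
open import Relation.Binary.PropositionalEquality
  using (refl; sym; trans; cong; cong₂; subst; subst₂)

module _ where
  open import Data.Vec using ([]; _∷_)
  open import Data.Fin.Subset using (inside; outside)

  ∣p∪q∣≤∣p∣+∣q∣ : ∀ {n} (p q : Subset n) → ∣ p ∪ q ∣ ≤ ∣ p ∣ + ∣ q ∣
  ∣p∪q∣≤∣p∣+∣q∣ []            []            = z≤n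
  ∣p∪q∣≤∣p∣+∣q∣ (inside  ∷ p) (inside  ∷ q) =
    s≤s (≤-trans (∣p∪q∣≤∣p∣+∣q∣ p q) (+-monoʳ-≤ ∣ p ∣ (n≤1+n ∣ q ∣)))
  ∣p∪q∣≤∣p∣+∣q∣ (inside  ∷ p) (outside ∷ q) = s≤s (∣p∪q∣≤∣p∣+∣q∣ p q)
  ∣p∪q∣≤∣p∣+∣q∣ (outside ∷ p) (inside  ∷ q) =
    ≤-trans (s≤s (∣p∪q∣≤∣p∣+∣q∣ p q)) (≤-reflexive (sym (+-suc ∣ p ∣ ∣ q ∣)))
  ∣p∪q∣≤∣p∣+∣q∣ (outside ∷ p) (outside ∷ q) = ∣p∪q∣≤∣p∣+∣q∣ p q

x∈p∧y∉p⇒x≢y : ∀ {n} {p : Subset n} {x y} → x ∈ p → y ∉ p → x ≢ y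
x∈p∧y∉p⇒x≢y {p = p} x∈p y∉p x≡y = y∉p (subst (_∈ p) x≡y x∈p)

x∈p∧x∉q⇒p≢q : ∀ {n} {p q : Subset n} {x} → x ∈ p → x ∉ q → p ≢ q
x∈p∧x∉q⇒p≢q {x = x} x∈p x∉q p≡q = x∉q (subst (x ∈_) p≡q x∈p)

∣p∣<∣p∪q∣⇒q≢∅ : ∀ {n} (p q : Subset n) → ∣ p ∣ < ∣ p ∪ q ∣ → Nonempty q
∣p∣<∣p∪q∣⇒q≢∅ {n} p q ∣p∣<∣p∪q∣ with nonempty? q
... | yes q≢∅ = q≢∅
... | no  q≡∅ = contradiction ∣p∣<∣p∣ (<-irrefl refl)
  where
  ∣p∣<∣p∣ : ∣ p ∣ < ∣ p ∣
  ∣p∣<∣p∣ = begin-strict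
    ∣ p ∣           <⟨ ∣p∣<∣p∪q∣ ⟩
    ∣ p ∪ q ∣       ≤⟨ ∣p∪q∣≤∣p∣+∣q∣ p q ⟩
    ∣ p ∣ + ∣ q ∣   ≡⟨ cong (∣ p ∣ +_) (trans (cong ∣_∣ (Empty-unique q≡∅)) (∣⊥∣≡0 n)) ⟩
    ∣ p ∣ + 0       ≡⟨ +-identityʳ ∣ p ∣ ⟩
    ∣ p ∣           ∎
    where open ≤-Reasoning

p∩q⊆r∧x∈r∧x∉p⇒∣p∩q∣<∣r∣ : ∀ {n} {p q r : Subset n} {x} →
  p ∩ q ⊆ r → x ∈ r → x ∉ p → ∣ p ∩ q ∣ < ∣ r ∣
p∩q⊆r∧x∈r∧x∉p⇒∣p∩q∣<∣r∣ {p = p} {q} {r} {x} p∩q⊆r x∈r x∉p =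
  ≤-<-trans (p⊆q⇒∣p∣≤∣q∣ p∩q⊆r-x) (x∈p⇒∣p-x∣<∣p∣ x∈r)
  where
  p∩q⊆r-x : p ∩ q ⊆ r - x
  p∩q⊆r-x y∈p∩q = x∈p∧x≢y⇒x∈p-y (p∩q⊆r y∈p∩q) (x∈p∧y∉p⇒x≢y (proj₁ (x∈p∩q⁻ p q y∈p∩q)) x∉p)

p∩q⊆[r-x-y]∪[p─r∩q─r] : ∀ {n} {p q r : Subset n} {x y} → x ∉ p → y ∉ q →
  p ∩ q ⊆ (r - x - y) ∪ ((p ─ r) ∩ (q ─ r))
p∩q⊆[r-x-y]∪[p─r∩q─r] {p = p} {q} {r} x∉p y∉q {z} z∈p∩q with x∈p∩q⁻ p q z∈p∩q | z ∈? r
... | z∈p , z∈q | yes z∈r =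
  p⊆p∪q _ (x∈p∧x≢y⇒x∈p-y (x∈p∧x≢y⇒x∈p-y z∈r (x∈p∧y∉p⇒x≢y z∈p x∉p)) (x∈p∧y∉p⇒x≢y z∈q y∉q))
... | z∈p , z∈q | no z∉r =
  q⊆p∪q _ _ (x∈p∩q⁺ (x∈p∧x∉q⇒x∈p─q z∈p z∉r , x∈p∧x∉q⇒x∈p─q z∈q z∉r))

Disjoint : ∀ {n} → Subset n → Subset n → Set
Disjoint p q = ∀ {x} → x ∈ p → x ∉ q

∩≡⊥⇒Disjoint : ∀ {n} {p q : Subset n} → p ∩ q ≡ ⊥ → Disjoint p q
∩≡⊥⇒Disjoint p∩q≡⊥ x∈p x∈q = ∉⊥ (subst (_ ∈_) p∩q≡⊥ (x∈p∩q⁺ (x∈p , x∈q)))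

[r∪p]∩q⊆r : ∀ {n} {p q r : Subset n} → Disjoint p q → (r ∪ p) ∩ q ⊆ r
[r∪p]∩q⊆r {p = p} {q} {r} p#q y∈[r∪p]∩q with x∈p∩q⁻ (r ∪ p) q y∈[r∪p]∩q
... | y∈r∪p , y∈q with x∈p∪q⁻ r p y∈r∪p
...   | inj₁ y∈r = y∈r
...   | inj₂ y∈p = contradiction y∈q (p#q y∈p)

[r∪p]∩[r∪q]⊆r : ∀ {n} {p q r : Subset n} → Disjoint p q → (r ∪ p) ∩ (r ∪ q) ⊆ r
[r∪p]∩[r∪q]⊆r {p = p} {q} {r} p#q y∈[r∪p]∩[r∪q] with x∈p∩q⁻ (r ∪ p) (r ∪ q) y∈[r∪p]∩[r∪q]
... | y∈r∪p , y∈r∪q with x∈p∪q⁻ r q y∈r∪q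
...   | inj₁ y∈r = y∈r
...   | inj₂ y∈q = [r∪p]∩q⊆r p#q (x∈p∩q⁺ (y∈r∪p , y∈q))

PairwiseDisjoint : ∀ {n u} → (Fin u → Subset n) → Set
PairwiseDisjoint P = ∀ i j → i ≢ j → Disjoint (P i) (P j)

-- Each member of P that meets X uses up an element of X not met by any other member,
-- so at most ∣ X ∣ of the u members meet X.
select-avoiding : ∀ {n u m} (P : Fin u → Subset n) (X : Subset n) →
  PairwiseDisjoint P → ∣ X ∣ + m ≤ u →
  Σ (Fin m → Fin u) λ σ → Injective _≡_ _≡_ σ × (∀ j → Disjoint (P (σ j)) X)
select-avoiding {m = zero} P X _ _ = (λ ()) , (λ { {()} }) , (λ ())
select-avoiding {u = zero} {m = suc m} P X _ X+m≤0 =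
  contradiction (≤-trans (m≤n+m (suc m) ∣ X ∣) X+m≤0) λ ()
select-avoiding {u = suc u} {m = suc m} P X P-disjoint X+m≤u with nonempty? (X ∩ P zero)
... | yes X∩P₀≢∅ = suc ∘ σ , suc∘σ-injective , avoids
  where
  tail-disjoint : PairwiseDisjoint (P ∘ suc)
  tail-disjoint i j i≢j = P-disjoint (suc i) (suc j) (i≢j ∘ suc-injective)
  rest = select-avoiding (P ∘ suc) (X ─ P zero) tail-disjoint
           (s≤s⁻¹ (≤-trans (+-monoˡ-≤ (suc m) (p∩q≢∅⇒∣p─q∣<∣p∣ X (P zero) X∩P₀≢∅)) X+m≤u))
  σ = proj₁ rest
  suc∘σ-injective : Injective _≡_ _≡_ (suc ∘ σ)
  suc∘σ-injective = proj₁ (proj₂ rest) ∘ suc-injective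
  avoids : ∀ j → Disjoint (P (suc (σ j))) X
  avoids j y∈P y∈X =
    proj₂ (proj₂ rest) j y∈P (x∈p∧x∉q⇒x∈p─q y∈X (P-disjoint (suc (σ j)) zero (λ ()) y∈P))
... | no X∩P₀≡∅ = σ , σ-injective , avoids
  where
  tail-disjoint : PairwiseDisjoint (P ∘ suc)
  tail-disjoint i j i≢j = P-disjoint (suc i) (suc j) (i≢j ∘ suc-injective)
  rest = select-avoiding (P ∘ suc) X tail-disjoint
           (s≤s⁻¹ (≤-trans (≤-reflexive (sym (+-suc ∣ X ∣ m))) X+m≤u))
  σ : Fin (suc m) → Fin (suc u)
  σ = zero ∷ suc ∘ proj₁ rest
  σ-injective : Injective _≡_ _≡_ σ
  σ-injective {zero}  {zero}  _  = refl
  σ-injective {suc i} {suc j} eq = cong suc (proj₁ (proj₂ rest) (suc-injective eq))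
  avoids : ∀ j → Disjoint (P (σ j)) X
  avoids zero    y∈P₀ y∈X = X∩P₀≡∅ (_ , x∈p∩q⁺ (y∈X , y∈P₀))
  avoids (suc j) = proj₂ (proj₂ rest) j

record SunflowerAvoiding {n} (𝓕 : Family n) (T X : Subset n) (m : ℕ) : Set where
  field
    set       : Fin m → Subset n
    ∈𝓕        : ∀ j → 𝓕 (set j)
    kernel⊆   : ∀ j → T ⊆ set j
    ∩⊆kernel  : ∀ i j → i ≢ j → set i ∩ set j ⊆ T
    ∩X⊆kernel : ∀ j → set j ∩ X ⊆ T
    distinct  : ∀ i j → i ≢ j → set i ≢ set j

  p⊆X⇒p∩set⊆kernel : ∀ {p} j → p ⊆ X → p ∩ set j ⊆ T
  p⊆X⇒p∩set⊆kernel {p} j p⊆X y∈p∩set with x∈p∩q⁻ p (set j) y∈p∩set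
  ... | y∈p , y∈set = ∩X⊆kernel j (x∈p∩q⁺ (y∈set , p⊆X y∈p))

sunflowerAvoiding : ∀ {n k u m} {𝓕 : Family n} {T : Subset n} (X : Subset n) →
  HasSunflower 𝓕 k T u → ∣ T ∣ < k → ∣ X ∣ + m ≤ u → SunflowerAvoiding 𝓕 T X m
sunflowerAvoiding {n} {m = m} {T = T} X (P , T∩P≡⊥ , P∩P≡⊥ , T∪P∈𝓕 , ∣T∪P∣≡k) ∣T∣<k X+m≤u = record
  { set       = set
  ; ∈𝓕        = T∪P∈𝓕 ∘ σ
  ; kernel⊆   = λ j → p⊆p∪q (P (σ j))
  ; ∩⊆kernel  = λ i j i≢j → [r∪p]∩[r∪q]⊆r (P-disjoint (σ i) (σ j) (i≢j ∘ σ-injective))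
  ; ∩X⊆kernel = λ j → [r∪p]∩q⊆r (σ-avoids j)
  ; distinct  = distinct
  }
  where
  P-disjoint : PairwiseDisjoint P
  P-disjoint i j i≢j = ∩≡⊥⇒Disjoint (P∩P≡⊥ i j i≢j)
  selection = select-avoiding P X P-disjoint X+m≤u
  σ = proj₁ selection
  σ-injective : Injective _≡_ _≡_ σ
  σ-injective = proj₁ (proj₂ selection)
  σ-avoids : ∀ j → Disjoint (P (σ j)) X
  σ-avoids = proj₂ (proj₂ selection)
  set : Fin m → Subset n
  set j = T ∪ P (σ j)
  distinct : ∀ i j → i ≢ j → set i ≢ set j
  distinct i j i≢j set-i≡set-j with ∣p∣<∣p∪q∣⇒q≢∅ T (P (σ i)) (subst (∣ T ∣ <_) (sym (∣T∪P∣≡k (σ i))) ∣T∣<k)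
  ... | y , y∈P =
    ∩≡⊥⇒Disjoint (T∩P≡⊥ (σ i))
      ([r∪p]∩[r∪q]⊆r (P-disjoint (σ i) (σ j) (i≢j ∘ σ-injective))
        (x∈p∩q⁺ (y∈set-i , subst (y ∈_) set-i≡set-j y∈set-i)))
      y∈P
    where y∈set-i = q⊆p∪q T (P (σ i)) y∈P

∷-distinct : ∀ {A : Set} {m} {x : A} {xs : Fin m → A} →
  (∀ j → xs j ≢ x) → (∀ i j → i ≢ j → xs i ≢ xs j) →
  ∀ i j → i ≢ j → (x ∷ xs) i ≢ (x ∷ xs) j
∷-distinct _   _        zero    zero    i≢j = contradiction refl i≢j
∷-distinct x∉xs _       zero    (suc j) _   = x∉xs j ∘ sym
∷-distinct x∉xs _       (suc i) zero    _   = x∉xs i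
∷-distinct _   distinct (suc i) (suc j) i≢j = distinct i j (i≢j ∘ cong suc)

sumFin-≤ : ∀ m {f : Fin m → ℕ} {c} → (∀ j → f j ≤ c) → sumFin m f ≤ m * c
sumFin-≤ zero    _   = z≤n
sumFin-≤ (suc m) f≤c = +-mono-≤ (f≤c zero) (sumFin-≤ m (f≤c ∘ suc))

suc[m]C2≡m+mC2 : ∀ m → suc m C 2 ≡ m + m C 2
suc[m]C2≡m+mC2 m = trans (sym (nCk+nC[k+1]≡[n+1]C[k+1] m 1)) (cong (_+ m C 2) (nC1≡n m))

pairSum-≤ : ∀ m {g : Fin m → Fin m → ℕ} {c} → (∀ i j → i ≢ j → g i j ≤ c) →
  pairSum m g ≤ (m C 2) * c
pairSum-≤ zero    _   = z≤n
pairSum-≤ (suc m) {g} {c} g≤c = begin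
  pairSum (suc m) g    ≤⟨ +-mono-≤ (sumFin-≤ m (λ j → g≤c zero (suc j) λ ()))
                                   (pairSum-≤ m (λ i j i≢j → g≤c (suc i) (suc j) (i≢j ∘ suc-injective))) ⟩
  m * c + (m C 2) * c  ≡⟨ sym (*-distribʳ-+ c m (m C 2)) ⟩
  (m + m C 2) * c      ≡⟨ cong (_* c) (sym (suc[m]C2≡m+mC2 m)) ⟩
  (suc m C 2) * c      ∎
  where open ≤-Reasoning

pairSum-≤-cons₂ : ∀ m (g : Fin (suc (suc m)) → Fin (suc (suc m)) → ℕ) {c₀₁ c₀ c₁ c} →
  g zero (suc zero) ≤ c₀₁ →
  (∀ j → g zero (suc (suc j)) ≤ c₀) →
  (∀ j → g (suc zero) (suc (suc j)) ≤ c₁) →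
  (∀ i j → i ≢ j → g (suc (suc i)) (suc (suc j)) ≤ c) →
  pairSum (suc (suc m)) g ≤ c₀₁ + m * c₀ + (m * c₁ + (m C 2) * c)
pairSum-≤-cons₂ m g g₀₁≤ g₀≤ g₁≤ g≤ =
  +-mono-≤ (+-mono-≤ g₀₁≤ (sumFin-≤ m g₀≤)) (+-mono-≤ (sumFin-≤ m g₁≤) (pairSum-≤ m g≤))

-- With c = M C 2 the left side is B + (r + M) and the right side B + (s + x),
-- where B = M r + M r + c (r + 1).
binomial-count⇒M<x : ∀ M r s x → s < r →
  (suc (suc M) C 2) * r + suc M C 2 ≤ s + x + M * r + (M * r + (M C 2) * suc r) → M < x
binomial-count⇒M<x M r s x s<r count = +-cancelˡ-≤ s _ _ (begin
  s + suc M  ≡⟨ +-suc s M ⟩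
  suc s + M  ≤⟨ +-monoˡ-≤ M s<r ⟩
  r + M      ≤⟨ +-cancelˡ-≤ (M * r + M * r + c * suc r) _ _ (subst₂ _≤_ lhs (rhs M r c s x) count) ⟩
  s + x      ∎)
  where
  open ≤-Reasoning
  c = M C 2
  lhs-poly : ∀ M r c → (suc M + (M + c)) * r + (M + c) ≡ (M * r + M * r + c * suc r) + (r + M)
  lhs-poly = solve-∀
  rhs : ∀ M r c s x → s + x + M * r + (M * r + c * suc r) ≡ (M * r + M * r + c * suc r) + (s + x)
  rhs = solve-∀
  lhs : (suc (suc M) C 2) * r + suc M C 2 ≡ (M * r + M * r + c * suc r) + (r + M)
  lhs = trans (cong₂ (λ p q → p * r + q)
                     (trans (suc[m]C2≡m+mC2 (suc M)) (cong (suc M +_) (suc[m]C2≡m+mC2 M)))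
                     (suc[m]C2≡m+mC2 M))
              (lhs-poly M r c)

uniform⇒∣p∪q∣≤2k : ∀ {n k} {𝓕 : Family n} {p q : Subset n} →
  Uniform k 𝓕 → 𝓕 p → 𝓕 q → ∣ p ∪ q ∣ ≤ 2 * k
uniform⇒∣p∪q∣≤2k {k = k} {p = p} {q} uniform p∈𝓕 q∈𝓕 = begin
  ∣ p ∪ q ∣       ≤⟨ ∣p∪q∣≤∣p∣+∣q∣ p q ⟩
  ∣ p ∣ + ∣ q ∣   ≡⟨ cong₂ _+_ (uniform p p∈𝓕) (trans (uniform q q∈𝓕) (sym (+-identityʳ k))) ⟩
  2 * k           ∎
  where open ≤-Reasoning

module TwoLinks {n r} {𝓕 : Family n} {T : Subset n} {a b : Fin n} {F G : Subset n}
  (∣T∣≡1+r : ∣ T ∣ ≡ suc r) (a∈T : a ∈ T) (b∈T : b ∈ T) (a≢b : a ≢ b)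
  (F∈link : InLink 𝓕 T a F) (G∈link : InLink 𝓕 T b G) where

  private
    a∉F : a ∉ F
    a∉F = proj₂ (proj₂ F∈link)
    b∉G : b ∉ G
    b∉G = proj₂ (proj₂ G∈link)
    a∈G : a ∈ G
    a∈G = proj₁ (proj₂ G∈link) (x∈p∧x≢y⇒x∈p-y a∈T a≢b)

  ∣T-a-b∣<r : ∣ T - a - b ∣ < r
  ∣T-a-b∣<r = <-≤-trans (x∈p⇒∣p-x∣<∣p∣ (x∈p∧x≢y⇒x∈p-y b∈T (a≢b ∘ sym)))
                        (s≤s⁻¹ (subst (∣ T - a ∣ <_) ∣T∣≡1+r (x∈p⇒∣p-x∣<∣p∣ a∈T)))

  ∣F∩G∣≤ : ∣ F ∩ G ∣ ≤ ∣ T - a - b ∣ + ∣ (F ─ T) ∩ (G ─ T) ∣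
  ∣F∩G∣≤ = ≤-trans (p⊆q⇒∣p∣≤∣q∣ (p∩q⊆[r-x-y]∪[p─r∩q─r] {r = T} a∉F b∉G))
                   (∣p∪q∣≤∣p∣+∣q∣ (T - a - b) ((F ─ T) ∩ (G ─ T)))

  module _ {m} (S : SunflowerAvoiding 𝓕 T (F ∪ G) m) where
    open SunflowerAvoiding S

    members : Fin (suc (suc m)) → Subset n
    members = F ∷ G ∷ set

    members-distinct : DistinctMembers 𝓕 (suc (suc m)) members
    members-distinct = ∈𝓕′ , ∷-distinct
      (λ { zero → x∈p∧x∉q⇒p≢q a∈G a∉F ; (suc j) → x∈p∧x∉q⇒p≢q (kernel⊆ j a∈T) a∉F })
      (∷-distinct (λ j → x∈p∧x∉q⇒p≢q (kernel⊆ j b∈T) b∉G) distinct)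
      where
      ∈𝓕′ : ∀ i → 𝓕 (members i)
      ∈𝓕′ zero          = proj₁ F∈link
      ∈𝓕′ (suc zero)    = proj₁ G∈link
      ∈𝓕′ (suc (suc j)) = ∈𝓕 j

    pairSum-members-≤ : pairSum (suc (suc m)) (λ i j → ∣ members i ∩ members j ∣)
      ≤ ∣ T - a - b ∣ + ∣ (F ─ T) ∩ (G ─ T) ∣ + m * r + (m * r + (m C 2) * suc r)
    pairSum-members-≤ =
      pairSum-≤-cons₂ m (λ i j → ∣ members i ∩ members j ∣) ∣F∩G∣≤ ∣F∩set∣≤ ∣G∩set∣≤ ∣set∩set∣≤
      where
      ∣F∩set∣≤ : ∀ j → ∣ F ∩ set j ∣ ≤ r
      ∣F∩set∣≤ j = s≤s⁻¹ (subst (∣ F ∩ set j ∣ <_) ∣T∣≡1+r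
        (p∩q⊆r∧x∈r∧x∉p⇒∣p∩q∣<∣r∣ (p⊆X⇒p∩set⊆kernel j (p⊆p∪q G)) a∈T a∉F))
      ∣G∩set∣≤ : ∀ j → ∣ G ∩ set j ∣ ≤ r
      ∣G∩set∣≤ j = s≤s⁻¹ (subst (∣ G ∩ set j ∣ <_) ∣T∣≡1+r
        (p∩q⊆r∧x∈r∧x∉p⇒∣p∩q∣<∣r∣ (p⊆X⇒p∩set⊆kernel j (q⊆p∪q F G)) b∈T b∉G))
      ∣set∩set∣≤ : ∀ i j → i ≢ j → ∣ set i ∩ set j ∣ ≤ suc r
      ∣set∩set∣≤ i j i≢j = subst (∣ set i ∩ set j ∣ ≤_) ∣T∣≡1+r (p⊆q⇒∣p∣≤∣q∣ (∩⊆kernel i j i≢j))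

lemma4 : (n t ℓ k : ℕ) → 1 ≤ t → 3 ≤ ℓ → t + ℓ ∸ 2 ≤ k →
    (𝓕 : Family n) → Uniform k 𝓕 →
    (∀ (Fs : Fin ℓ → Subset n) → DistinctMembers 𝓕 ℓ Fs →
      (ℓ C 2) * (t ∸ 1) + ((ℓ ∸ 1) C 2) ≤ pairSum ℓ (λ i j → ∣ Fs i ∩ Fs j ∣)) →
    (T : Subset n) → ∣ T ∣ ≡ t → HasSunflower 𝓕 k T (2 * k + ℓ ∸ 2) →
    (a b : Fin n) → a ∈ T → b ∈ T → a ≢ b →
    (F G : Subset n) → InLink 𝓕 T a F → InLink 𝓕 T b G →
    ℓ ∸ 1 ≤ ∣ (F ─ T) ∩ (G ─ T) ∣
lemma4 n t ℓ k (s≤s {n = r} z≤n) (s≤s (s≤s (s≤s {n = m} z≤n))) t+ℓ∸2≤k 𝓕 uniform intersecting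
       T ∣T∣≡t sunflower a b a∈T b∈T a≢b F G F∈link G∈link =
  binomial-count⇒M<x M r ∣ T - a - b ∣ ∣ (F ─ T) ∩ (G ─ T) ∣ ∣T-a-b∣<r
    (≤-trans (intersecting (members S) (members-distinct S)) (pairSum-members-≤ S))
  where
  open TwoLinks {𝓕 = 𝓕} ∣T∣≡t a∈T b∈T a≢b F∈link G∈link
  open ≤-Reasoning
  M = suc m
  ∣T∣<k : ∣ T ∣ < k
  ∣T∣<k = begin-strict
    ∣ T ∣       ≡⟨ ∣T∣≡t ⟩
    t           <⟨ m<m+n t {M} (s≤s z≤n) ⟩
    t + M       ≡⟨ sym (+-∸-assoc t {ℓ} (s≤s (s≤s z≤n))) ⟩
    t + ℓ ∸ 2   ≤⟨ t+ℓ∸2≤k ⟩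
    k           ∎
  ∣F∪G∣+M≤u : ∣ F ∪ G ∣ + M ≤ 2 * k + ℓ ∸ 2
  ∣F∪G∣+M≤u = begin
    ∣ F ∪ G ∣ + M   ≤⟨ +-monoˡ-≤ M (uniform⇒∣p∪q∣≤2k uniform (proj₁ F∈link) (proj₁ G∈link)) ⟩
    2 * k + M       ≡⟨ sym (+-∸-assoc (2 * k) {ℓ} (s≤s (s≤s z≤n))) ⟩
    2 * k + ℓ ∸ 2   ∎
  S = sunflowerAvoiding {𝓕 = 𝓕} (F ∪ G) sunflower ∣T∣<k ∣F∪G∣+M≤u
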